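{- Let $\ell \ge 4$, let $F \in \mathfrak F^+_\ell$, and let $G \subseteq F$ be a subhypergraph with $v_G \ge 2$. Then $e_G \le v_G - \bigl(2 + \mathbb 1\{v_G \ge 4 \text{ and } G \ne F\}\bigr)$.
   Context: For a $3$-uniform hypergraph $F$, $v_F$ and $e_F$ denote its numbers of vertices and triples. $\mathfrak F^+_\ell$ is the collection of all $3$-uniform hypergraphs $F$ with $4 \le v_F \le \ell$ and $e_F = v_F - 2$ such that $F$ contains no subhypergraph $J \subsetneq F$ with $v_J \ge 4$ and $e_J = v_J - 2$. A subhypergraph $G \subseteq F$ consists of a vertex subset $V(G)\subseteq V(F)$ and a set of triples of $F$ contained in $V(G)$. $\mathbb 1\{\cdot\}$ is the indicator. -}

module Defs where

open import Data.Nat using (ℕ; _+_; _≤_; _≤?_)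
open import Data.Fin using (Fin)
open import Data.Fin.Subset using (Subset; _⊆_; _∈_; ∣_∣; ⊤)
open import Data.Vec.Properties using (≡-dec)
import Data.Bool as B
open import Data.Product using (_×_; Σ)
open import Relation.Binary.PropositionalEquality using (_≡_)
open import Relation.Nullary using (¬_; Dec; yes; no)
open import Relation.Nullary.Decidable using (_×-dec_; ¬?)

record Hypergraph3 : Set where
  field
    n      : ℕ
    m      : ℕ
    edge   : Fin m → Subset n
    size3  : ∀ i → ∣ edge i ∣ ≡ 3
    inj    : ∀ i j → edge i ≡ edge j → i ≡ j
open Hypergraph3 public

v : Hypergraph3 → ℕ
v F = n F

e : Hypergraph3 → ℕ
e F = m F

record Sub (F : Hypergraph3) : Set where
  field
    verts  : Subset (n F)
    edges  : Subset (m F)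
    closed : ∀ i → i ∈ edges → edge F i ⊆ verts
open Sub public

vS : {F : Hypergraph3} → Sub F → ℕ
vS G = ∣ verts G ∣

eS : {F : Hypergraph3} → Sub F → ℕ
eS G = ∣ edges G ∣

IsWhole : {F : Hypergraph3} → Sub F → Set
IsWhole G = (verts G ≡ ⊤) × (edges G ≡ ⊤)

isWhole? : {F : Hypergraph3} (G : Sub F) → Dec (IsWhole G)
isWhole? G = (≡-dec B._≟_ (verts G) ⊤) ×-dec (≡-dec B._≟_ (edges G) ⊤)

InFPlus : ℕ → Hypergraph3 → Set
InFPlus ℓ F =
  (4 ≤ v F) × (v F ≤ ℓ) × (e F + 2 ≡ v F) ×
  (∀ (J : Sub F) → ¬ IsWhole J → ¬ ((4 ≤ vS J) × (eS J + 2 ≡ vS J)))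

𝟙 : {P : Set} → Dec P → ℕ
𝟙 (yes _) = 1
𝟙 (no _)  = 0

indProper : {F : Hypergraph3} → Sub F → ℕ
indProper G = 𝟙 ((4 ≤? vS G) ×-dec ¬? (isWhole? G))

-- For v_G ≤ 3 a triple inside V(G) is V(G) itself, so G has at most one
-- triple. For v_G ≥ 4, if G had more than v_G − 2 triples, keeping any
-- v_G − 2 of them on the vertex set of G would give a subhypergraph J with
-- e_J = v_J − 2, which by minimality of F must be F itself; then F has only
-- v_G − 2 triples, fewer than G. Finally, for G ≠ F minimality excludes
-- e_G = v_G − 2 as well.
module Submission where

open import Defs
open import Data.Nat using (ℕ; _+_; _≤_; zero; suc; _∸_; z≤n; s≤s; _≤?_)
open import Data.Nat.Properties
  using ( suc-injective; ≤-trans; ≤-antisym; ≤-pred; +-monoˡ-≤; +-suc; +-comm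
        ; <⇒≤; <⇒≢; ≰⇒>; ≤∧≢⇒<; m∸n+n≡m; m≤n+o⇒m∸n≤o; m≤o∸n⇒m+n≤o; module ≤-Reasoning)
open import Data.Fin using (Fin; zero; suc)
open import Data.Fin.Subset using (Subset; _⊆_; _∈_; ∣_∣; ⊤; ⊥; inside; outside; ⁅_⁆)
open import Data.Fin.Subset.Properties
  using ( ⊥⊆; ∣⊥∣≡0; out⊆; in⊆in; drop-∷-⊆; p⊆q⇒∣p∣≤∣q∣; ∣p∣≤n; ∣⊤∣≡n
        ; x∈⁅x⁆; ∣⁅x⁆∣≡1; nonempty?; Empty-unique)
open import Data.Vec.Base using (_∷_; []; here)
open import Data.Product using (∃; _,_; _×_; proj₂)
open import Relation.Nullary using (¬_; Dec; yes; no; contradiction)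
open import Relation.Nullary.Decidable using (decidable-stable)
open import Relation.Binary.PropositionalEquality using (_≡_; refl; sym; trans; cong; subst)

p⊆q∧∣p∣≡∣q∣⇒p≡q : ∀ {n} {p q : Subset n} → p ⊆ q → ∣ p ∣ ≡ ∣ q ∣ → p ≡ q
p⊆q∧∣p∣≡∣q∣⇒p≡q {p = []}          {[]}          _   _  = refl
p⊆q∧∣p∣≡∣q∣⇒p≡q {p = inside ∷ p}  {inside ∷ q}  p⊆q eq =
  cong (inside ∷_) (p⊆q∧∣p∣≡∣q∣⇒p≡q (drop-∷-⊆ p⊆q) (suc-injective eq))
p⊆q∧∣p∣≡∣q∣⇒p≡q {p = outside ∷ p} {outside ∷ q} p⊆q eq =
  cong (outside ∷_) (p⊆q∧∣p∣≡∣q∣⇒p≡q (drop-∷-⊆ p⊆q) eq)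
p⊆q∧∣p∣≡∣q∣⇒p≡q {p = inside ∷ p}  {outside ∷ q} p⊆q eq with p⊆q here
... | ()
p⊆q∧∣p∣≡∣q∣⇒p≡q {p = outside ∷ p} {inside ∷ q}  p⊆q eq =
  contradiction eq (<⇒≢ (s≤s (p⊆q⇒∣p∣≤∣q∣ (drop-∷-⊆ p⊆q))))

k≤∣p∣⇒∃q⊆p∧∣q∣≡k : ∀ {n} (p : Subset n) k → k ≤ ∣ p ∣ → ∃ λ q → q ⊆ p × ∣ q ∣ ≡ k
k≤∣p∣⇒∃q⊆p∧∣q∣≡k {n} p zero _ = ⊥ , ⊥⊆ , ∣⊥∣≡0 n
k≤∣p∣⇒∃q⊆p∧∣q∣≡k (outside ∷ p) (suc k) k<∣p∣ with k≤∣p∣⇒∃q⊆p∧∣q∣≡k p (suc k) k<∣p∣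
... | q , q⊆p , ∣q∣≡k = outside ∷ q , out⊆ q⊆p , ∣q∣≡k
k≤∣p∣⇒∃q⊆p∧∣q∣≡k (inside ∷ p) (suc k) (s≤s k≤∣p∣) with k≤∣p∣⇒∃q⊆p∧∣q∣≡k p k k≤∣p∣
... | q , q⊆p , ∣q∣≡k = inside ∷ q , in⊆in q⊆p , cong suc ∣q∣≡k

module _ {F : Hypergraph3} where

  edge∈⇒3≤vS : (G : Sub F) {i : Fin (m F)} → i ∈ edges G → 3 ≤ vS G
  edge∈⇒3≤vS G {i} i∈G = subst (_≤ vS G) (size3 F i) (p⊆q⇒∣p∣≤∣q∣ (closed G i i∈G))

  edges⊆⁅edge⁆ : (G : Sub F) {i : Fin (m F)} → i ∈ edges G → vS G ≤ 3 → edges G ⊆ ⁅ i ⁆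
  edges⊆⁅edge⁆ G {i} i∈G vS≤3 {j} j∈G =
    subst (_∈ ⁅ i ⁆) (sym (inj F j i (trans (edge≡verts j∈G) (sym (edge≡verts i∈G))))) (x∈⁅x⁆ i)
    where
    edge≡verts : ∀ {j} → j ∈ edges G → edge F j ≡ verts G
    edge≡verts {j} j∈G = p⊆q∧∣p∣≡∣q∣⇒p≡q (closed G j j∈G)
      (trans (size3 F j) (≤-antisym (edge∈⇒3≤vS G j∈G) vS≤3))

  vS≤3⇒eS+2≤vS : (G : Sub F) → 2 ≤ vS G → vS G ≤ 3 → eS G + 2 ≤ vS G
  vS≤3⇒eS+2≤vS G 2≤vS vS≤3 with nonempty? (edges G)
  ... | no ¬ne = subst (λ k → k + 2 ≤ vS G) (sym (trans (cong ∣_∣ (Empty-unique ¬ne)) (∣⊥∣≡0 (m F)))) 2≤vS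
  ... | yes (i , i∈G) = begin
      eS G + 2      ≤⟨ +-monoˡ-≤ 2 (p⊆q⇒∣p∣≤∣q∣ (edges⊆⁅edge⁆ G i∈G vS≤3)) ⟩
      ∣ ⁅ i ⁆ ∣ + 2 ≡⟨ cong (_+ 2) (∣⁅x⁆∣≡1 i) ⟩
      3             ≤⟨ edge∈⇒3≤vS G i∈G ⟩
      vS G          ∎
    where open ≤-Reasoning

  withEdges : (G : Sub F) (q : Subset (m F)) → q ⊆ edges G → Sub F
  withEdges G q q⊆G = record { verts = verts G ; edges = q ; closed = λ i i∈q → closed G i (q⊆G i∈q) }

  Tight : Sub F → Set
  Tight J = (4 ≤ vS J) × (eS J + 2 ≡ vS J)

  module _ (minimal : ∀ (J : Sub F) → ¬ IsWhole J → ¬ Tight J) where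

    4≤vS⇒eS+2≤vS : (G : Sub F) → 4 ≤ vS G → eS G + 2 ≤ vS G
    4≤vS⇒eS+2≤vS G 4≤vS with eS G + 2 ≤? vS G
    ... | yes le = le
    ... | no  nle with k≤∣p∣⇒∃q⊆p∧∣q∣≡k (edges G) (vS G ∸ 2) vS∸2≤eS
      where
      vS∸2≤eS : vS G ∸ 2 ≤ eS G
      vS∸2≤eS = m≤n+o⇒m∸n≤o (vS G) 2 (subst (vS G ≤_) (+-comm (eS G) 2) (<⇒≤ (≰⇒> nle)))
    ... | q , q⊆G , ∣q∣≡vS∸2 = m≤o∸n⇒m+n≤o (eS G) 2≤vS (begin
        eS G      ≤⟨ ∣p∣≤n (edges G) ⟩
        m F       ≡⟨ sym (trans (cong ∣_∣ q≡⊤) (∣⊤∣≡n (m F))) ⟩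
        ∣ q ∣     ≡⟨ ∣q∣≡vS∸2 ⟩
        vS G ∸ 2  ∎)
      where
      open ≤-Reasoning
      2≤vS : 2 ≤ vS G
      2≤vS = ≤-trans (s≤s (s≤s z≤n)) 4≤vS
      J : Sub F
      J = withEdges G q q⊆G
      J-tight : Tight J
      J-tight = 4≤vS , trans (cong (_+ 2) ∣q∣≡vS∸2) (m∸n+n≡m 2≤vS)
      q≡⊤ : q ≡ ⊤
      q≡⊤ = proj₂ (decidable-stable (isWhole? J) (λ ¬whole → minimal J ¬whole J-tight))

    eS+2+𝟙≤vS : (G : Sub F) → 2 ≤ vS G → (d : Dec ((4 ≤ vS G) × ¬ IsWhole G)) → eS G + (2 + 𝟙 d) ≤ vS G
    eS+2+𝟙≤vS G _ (yes (4≤vS , ¬whole)) = subst (_≤ vS G) (sym (+-suc (eS G) 2))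
      (≤∧≢⇒< (4≤vS⇒eS+2≤vS G 4≤vS) (λ tight → minimal G ¬whole (4≤vS , tight)))
    eS+2+𝟙≤vS G 2≤vS (no _) with 4 ≤? vS G
    ... | yes 4≤vS = 4≤vS⇒eS+2≤vS G 4≤vS
    ... | no  4≰vS = vS≤3⇒eS+2≤vS G 2≤vS (≤-pred (≰⇒> 4≰vS))

lemma3p7 : (ℓ : ℕ) → 4 ≤ ℓ → (F : Hypergraph3) → InFPlus ℓ F →
    (G : Sub F) → 2 ≤ vS G → eS G + (2 + indProper G) ≤ vS G
lemma3p7 _ _ _ (_ , _ , _ , minimal) G 2≤vS = eS+2+𝟙≤vS minimal G 2≤vS _
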